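{- In a zerosumfree dagger monoidal additive category $\mathcal{C}$, the collection $\mathrm{pPred}(I)$ of positive predicates on the tensor unit is an effect monoid, with multiplication $p\cdot q=[p,\kappa_2]\circ q$ given by composition: $\pi_1\circ(p\cdot q)=(\pi_1\circ p)\circ(\pi_1\circ q)$.
   Context: $\mathcal{C}$ is a dagger biproduct category (biproducts $\oplus$ with $(\pi_i)^\dagger=\kappa_i$) with additive inverses, zerosumfree ($f+g=0\Rightarrow f=g=0$ for positive $f,g$, positive meaning $g^\dagger\circ g$), and dagger monoidal with tensor $(\otimes,I)$ ($(f\otimes g)^\dagger=f^\dagger\otimes g^\dagger$, monoidal isomorphisms unitary). A positive predicate on $X$ is $p=\langle p_1,p_2\rangle\colon X\to X\oplus X$ with $p_1+p_2=\mathrm{id}$ and $p_i$ positive; $\mathrm{pPred}(X)$ is an effect algebra with $1=\kappa_1$, $0=\kappa_2$, swap as orthocomplement, partial sum $p\boxplus q=(\nabla+\mathrm{id})\circ b$ for a positive bound $b\colon X\to(X\oplus X)\oplus X$ with $[\mathrm{id},\kappa_2]\circ b=p$, $[[\kappa_2,\kappa_1],\kappa_2]\circ b=q$. An effect monoid is an effect algebra with a monoid multiplication preserving $\boxplus$ in each argument and with unit 1. Positive maps $I\to I$ are closed under composition. Here $\boxplus$ denotes the partial sum operation. -}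

module Defs where

open import Level using (Level; _⊔_) renaming (suc to lsuc)
open import Relation.Binary.PropositionalEquality using (_≡_)
open import Data.Product using (Σ; _×_)

record ZSFDaggerMonoidalAdditive (o h : Level) : Set (lsuc (o ⊔ h)) where
  infixr 9 _∘_
  infixl 6 _+_
  infixr 7 _⊗₀_ _⊗₁_
  infixr 6 _⊕_
  field
    Obj : Set o
    Hom : Obj → Obj → Set h
    id  : ∀ {X} → Hom X X
    _∘_ : ∀ {X Y Z} → Hom Y Z → Hom X Y → Hom X Z
    identityˡ : ∀ {X Y} (f : Hom X Y) → id ∘ f ≡ f
    identityʳ : ∀ {X Y} (f : Hom X Y) → f ∘ id ≡ f
    assoc : ∀ {W X Y Z} (f : Hom Y Z) (g : Hom X Y) (k : Hom W X) →
            (f ∘ g) ∘ k ≡ f ∘ (g ∘ k)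

    _+_ : ∀ {X Y} → Hom X Y → Hom X Y → Hom X Y
    0m  : ∀ {X Y} → Hom X Y
    -_  : ∀ {X Y} → Hom X Y → Hom X Y
    +-assoc : ∀ {X Y} (f g k : Hom X Y) → (f + g) + k ≡ f + (g + k)
    +-comm  : ∀ {X Y} (f g : Hom X Y) → f + g ≡ g + f
    +-identityˡ : ∀ {X Y} (f : Hom X Y) → 0m + f ≡ f
    +-inverseˡ  : ∀ {X Y} (f : Hom X Y) → (- f) + f ≡ 0m
    ∘-distribˡ-+ : ∀ {X Y Z} (f : Hom Y Z) (g k : Hom X Y) →
                   f ∘ (g + k) ≡ (f ∘ g) + (f ∘ k)
    ∘-distribʳ-+ : ∀ {X Y Z} (g k : Hom Y Z) (f : Hom X Y) →
                   (g + k) ∘ f ≡ (g ∘ f) + (k ∘ f)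

    _† : ∀ {X Y} → Hom X Y → Hom Y X
    †-involutive : ∀ {X Y} (f : Hom X Y) → (f †) † ≡ f
    †-id : ∀ {X} → (id {X}) † ≡ id
    †-∘  : ∀ {X Y Z} (f : Hom Y Z) (g : Hom X Y) → (f ∘ g) † ≡ (g †) ∘ (f †)

    _⊕_ : Obj → Obj → Obj
    π₁ : ∀ {X Y} → Hom (X ⊕ Y) X
    π₂ : ∀ {X Y} → Hom (X ⊕ Y) Y
    κ₁ : ∀ {X Y} → Hom X (X ⊕ Y)
    κ₂ : ∀ {X Y} → Hom Y (X ⊕ Y)
    π₁κ₁ : ∀ {X Y} → π₁ {X} {Y} ∘ κ₁ ≡ id
    π₂κ₂ : ∀ {X Y} → π₂ {X} {Y} ∘ κ₂ ≡ id
    π₁κ₂ : ∀ {X Y} → π₁ {X} {Y} ∘ κ₂ ≡ 0m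
    π₂κ₁ : ∀ {X Y} → π₂ {X} {Y} ∘ κ₁ ≡ 0m
    κπ-sum : ∀ {X Y} → (κ₁ ∘ π₁ {X} {Y}) + (κ₂ ∘ π₂) ≡ id
    π₁† : ∀ {X Y} → (π₁ {X} {Y}) † ≡ κ₁
    π₂† : ∀ {X Y} → (π₂ {X} {Y}) † ≡ κ₂

    zerosumfree : ∀ {X Y Z} (f : Hom X Y) (g : Hom X Z) →
                  ((f † ∘ f) + (g † ∘ g)) ≡ 0m →
                  ((f † ∘ f) ≡ 0m) × ((g † ∘ g) ≡ 0m)

    _⊗₀_ : Obj → Obj → Obj
    I    : Obj
    _⊗₁_ : ∀ {X Y X' Y'} → Hom X X' → Hom Y Y' → Hom (X ⊗₀ Y) (X' ⊗₀ Y')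
    ⊗-id : ∀ {X Y} → (id {X}) ⊗₁ (id {Y}) ≡ id
    ⊗-∘  : ∀ {X Y Z X' Y' Z'} (f : Hom Y Z) (g : Hom X Y)
             (f' : Hom Y' Z') (g' : Hom X' Y') →
           (f ∘ g) ⊗₁ (f' ∘ g') ≡ (f ⊗₁ f') ∘ (g ⊗₁ g')
    α  : ∀ {X Y Z} → Hom ((X ⊗₀ Y) ⊗₀ Z) (X ⊗₀ (Y ⊗₀ Z))
    α⁻¹ : ∀ {X Y Z} → Hom (X ⊗₀ (Y ⊗₀ Z)) ((X ⊗₀ Y) ⊗₀ Z)
    λ⊗  : ∀ {X} → Hom (I ⊗₀ X) X
    λ⊗⁻¹ : ∀ {X} → Hom X (I ⊗₀ X)
    ρ⊗  : ∀ {X} → Hom (X ⊗₀ I) X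
    ρ⊗⁻¹ : ∀ {X} → Hom X (X ⊗₀ I)
    αα⁻¹ : ∀ {X Y Z} → α {X} {Y} {Z} ∘ α⁻¹ ≡ id
    α⁻¹α : ∀ {X Y Z} → α⁻¹ {X} {Y} {Z} ∘ α ≡ id
    λλ⁻¹ : ∀ {X} → λ⊗ {X} ∘ λ⊗⁻¹ ≡ id
    λ⁻¹λ : ∀ {X} → λ⊗⁻¹ {X} ∘ λ⊗ ≡ id
    ρρ⁻¹ : ∀ {X} → ρ⊗ {X} ∘ ρ⊗⁻¹ ≡ id
    ρ⁻¹ρ : ∀ {X} → ρ⊗⁻¹ {X} ∘ ρ⊗ ≡ id
    α-natural : ∀ {X Y Z X' Y' Z'} (f : Hom X X') (g : Hom Y Y') (k : Hom Z Z') →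
                α ∘ ((f ⊗₁ g) ⊗₁ k) ≡ (f ⊗₁ (g ⊗₁ k)) ∘ α
    λ-natural : ∀ {X Y} (f : Hom X Y) → λ⊗ ∘ (id {I} ⊗₁ f) ≡ f ∘ λ⊗
    ρ-natural : ∀ {X Y} (f : Hom X Y) → ρ⊗ ∘ (f ⊗₁ id {I}) ≡ f ∘ ρ⊗
    triangle : ∀ {X Y} → (id {X} ⊗₁ λ⊗ {Y}) ∘ α ≡ ρ⊗ ⊗₁ id {Y}
    pentagon : ∀ {W X Y Z} →
               (id {W} ⊗₁ α {X} {Y} {Z}) ∘ (α ∘ (α ⊗₁ id {Z}))
                 ≡ α ∘ α {W ⊗₀ X} {Y} {Z}
    †-⊗ : ∀ {X Y X' Y'} (f : Hom X X') (g : Hom Y Y') → (f ⊗₁ g) † ≡ (f †) ⊗₁ (g †)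
    α-unitary : ∀ {X Y Z} → (α {X} {Y} {Z}) † ≡ α⁻¹
    λ-unitary : ∀ {X} → (λ⊗ {X}) † ≡ λ⊗⁻¹
    ρ-unitary : ∀ {X} → (ρ⊗ {X}) † ≡ ρ⊗⁻¹

  Positive : ∀ {X} → Hom X X → Set (o ⊔ h)
  Positive {X} f = Σ Obj λ Y → Σ (Hom X Y) λ g → f ≡ (g † ∘ g)

  [_,_] : ∀ {X Y Z} → Hom X Z → Hom Y Z → Hom (X ⊕ Y) Z
  [ f , g ] = (f ∘ π₁) + (g ∘ π₂)

  _⊕₁_ : ∀ {X Y X' Y'} → Hom X X' → Hom Y Y' → Hom (X ⊕ Y) (X' ⊕ Y')
  f ⊕₁ g = (κ₁ ∘ (f ∘ π₁)) + (κ₂ ∘ (g ∘ π₂))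

  ∇ : ∀ {X} → Hom (X ⊕ X) X
  ∇ = [ id , id ]

  swap : ∀ {X} → Hom (X ⊕ X) (X ⊕ X)
  swap = [ κ₂ , κ₁ ]

  IsPPred : ∀ {X} → Hom X (X ⊕ X) → Set (o ⊔ h)
  IsPPred p = Positive (π₁ ∘ p) × Positive (π₂ ∘ p) × ((π₁ ∘ p) + (π₂ ∘ p) ≡ id)

  IsPosBound : ∀ {X} → Hom X ((X ⊕ X) ⊕ X) → Set (o ⊔ h)
  IsPosBound b = Positive (π₁ ∘ (π₁ ∘ b)) × Positive (π₂ ∘ (π₁ ∘ b))
               × Positive (π₂ ∘ b)
               × ((π₁ ∘ (π₁ ∘ b)) + (π₂ ∘ (π₁ ∘ b)) + (π₂ ∘ b) ≡ id)

  -- the partial sum as a ternary relation:  PSum p q r  means  p ⊞ q is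
  -- defined (witnessed by a positive bound) and equals r
  PSum : ∀ {X} → Hom X (X ⊕ X) → Hom X (X ⊕ X) → Hom X (X ⊕ X) → Set (o ⊔ h)
  PSum {X} p q r = Σ (Hom X ((X ⊕ X) ⊕ X)) λ b →
      IsPosBound b
    × ([ id , κ₂ ] ∘ b ≡ p)
    × ([ [ κ₂ , κ₁ ] , κ₂ ] ∘ b ≡ q)
    × ((∇ ⊕₁ id) ∘ b ≡ r)

  _·_ : Hom I (I ⊕ I) → Hom I (I ⊕ I) → Hom I (I ⊕ I)
  p · q = [ p , κ₂ ] ∘ q

-- Effect algebras and effect monoids, on the subset of a type M cut out
-- by a predicate P, with the partial sum given as a ternary relation S
-- (S x y z  ⇔  x ⊞ y is defined and equals z).

record IsEffectAlgebra {a p r} {M : Set a} (P : M → Set p)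
       (S : M → M → M → Set r) (𝟘 𝟙 : M) (_ᗮ : M → M) : Set (a ⊔ p ⊔ r) where
  field
    𝟘-in : P 𝟘
    𝟙-in : P 𝟙
    ᗮ-in : ∀ {x} → P x → P (x ᗮ)
    S-in : ∀ {x y z} → P x → P y → S x y z → P z
    S-functional : ∀ {x y z z'} → P x → P y → S x y z → S x y z' → z ≡ z'
    S-comm : ∀ {x y z} → P x → P y → S x y z → S y x z
    S-assoc : ∀ {x y z u v} → P x → P y → P z → S x y u → S u z v →
              Σ M λ w → S y z w × S x w v
    S-𝟘 : ∀ {x} → P x → S 𝟘 x x
    ᗮ-sum : ∀ {x} → P x → S x (x ᗮ) 𝟙
    ᗮ-unique : ∀ {x y} → P x → P y → S x y 𝟙 → y ≡ x ᗮ
    zero-one : ∀ {x z} → P x → S x 𝟙 z → x ≡ 𝟘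

record IsEffectMonoid {a p r} {M : Set a} (P : M → Set p)
       (S : M → M → M → Set r) (𝟘 𝟙 : M) (_ᗮ : M → M) (_⋆_ : M → M → M)
       : Set (a ⊔ p ⊔ r) where
  field
    isEffectAlgebra : IsEffectAlgebra P S 𝟘 𝟙 _ᗮ
    ⋆-in : ∀ {x y} → P x → P y → P (x ⋆ y)
    ⋆-assoc : ∀ {x y z} → P x → P y → P z → (x ⋆ y) ⋆ z ≡ x ⋆ (y ⋆ z)
    ⋆-identityˡ : ∀ {x} → P x → 𝟙 ⋆ x ≡ x
    ⋆-identityʳ : ∀ {x} → P x → x ⋆ 𝟙 ≡ x
    ⋆-⊞ˡ : ∀ {x y z u} → P x → P y → P z → S y z u → S (x ⋆ y) (x ⋆ z) (x ⋆ u)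
    ⋆-⊞ʳ : ∀ {x y z u} → P x → P y → P z → S y z u → S (y ⋆ x) (z ⋆ x) (u ⋆ x)

module Submission where

-- A predicate x : X → X ⊕ X is the pairing ⟨ π₁ ∘ x , π₂ ∘ x ⟩ of its
-- components, so everything reduces to identities between endomorphisms.
-- After the algebra of hom-groups and biproducts, we show that a partial
-- sum x ⊞ y = z amounts to positive a, c, d with a + c + d = id and
-- x = ⟨a, c+d⟩, y = ⟨c, a+d⟩, z = ⟨a+c, d⟩ ('Decomposition'); from this
-- the effect-algebra axioms of pPred(X) follow for every object X.  The
-- product [ p , κ₂ ] ∘ q is Kleisli composition for (–) ⊕ X, hence
-- associative and unital, and on pairings it is
-- ⟨s₁, s₂⟩ · ⟨t₁, t₂⟩ = ⟨s₁ ∘ t₁, s₂ ∘ t₁ + t₂⟩, which yields the formula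
-- for π₁ ∘ (p · q) and distributivity over ⊞.  The one fact specific to I
-- is that positive scalars are closed under composition, which rests on
-- Kelly's coherence identity λ_I = ρ_I.

open import Defs
open import Level using (Level; _⊔_)
open import Relation.Binary.PropositionalEquality
  using (_≡_; refl; sym; trans; cong; cong₂; subst; isEquivalence; module ≡-Reasoning)
open import Data.Product using (_×_; _,_; Σ; proj₁; proj₂)
open import Algebra.Bundles using (AbelianGroup)
open import Algebra.Structures using (IsAbelianGroup)
import Algebra.Properties.AbelianGroup as AbelianGroupProperties
import Algebra.Properties.CommutativeSemigroup as CommutativeSemigroupProperties

module EffectMonoidOfScalars {o h : Level} (C : ZSFDaggerMonoidalAdditive o h) where
  open ZSFDaggerMonoidalAdditive C
  open ≡-Reasoning

  +-abelianGroup : (X Y : Obj) → AbelianGroup h h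
  +-abelianGroup X Y = record
    { _≈_ = _≡_ ; _∙_ = _+_ {X} {Y} ; ε = 0m ; _⁻¹ = -_
    ; isAbelianGroup = isAbelianGroup }
    where
      isAbelianGroup : IsAbelianGroup _≡_ (_+_ {X} {Y}) 0m -_
      isAbelianGroup = record
        { isGroup = record
          { isMonoid = record
            { isSemigroup = record
              { isMagma = record { isEquivalence = isEquivalence ; ∙-cong = cong₂ _+_ }
              ; assoc = +-assoc }
            ; identity = +-identityˡ , λ f → trans (+-comm f 0m) (+-identityˡ f) }
          ; inverse = +-inverseˡ , λ f → trans (+-comm f (- f)) (+-inverseˡ f)
          ; ⁻¹-cong = cong -_ }
        ; comm = +-comm }

  module HomGroup {X Y : Obj} = AbelianGroupProperties (+-abelianGroup X Y)
  module HomCommutative {X Y : Obj} = CommutativeSemigroupProperties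
    (AbelianGroup.commutativeSemigroup (+-abelianGroup X Y))

  +-identityʳ : ∀ {X Y} (f : Hom X Y) → f + 0m ≡ f
  +-identityʳ f = AbelianGroup.identityʳ (+-abelianGroup _ _) f

  +-cancelˡ : ∀ {X Y} (f : Hom X Y) {g k : Hom X Y} → f + g ≡ f + k → g ≡ k
  +-cancelˡ f {g} {k} = HomGroup.∙-cancelˡ f g k

  +-exchange : ∀ {X Y} (p q r s : Hom X Y) → p + ((q + r) + s) ≡ q + ((p + r) + s)
  +-exchange p q r s = begin
    p + ((q + r) + s)  ≡⟨ cong (p +_) (+-assoc q r s) ⟩
    p + (q + (r + s))  ≡⟨ HomCommutative.x∙yz≈y∙xz p q (r + s) ⟩
    q + (p + (r + s))  ≡⟨ cong (q +_) (sym (+-assoc p r s)) ⟩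
    q + ((p + r) + s)  ∎

  ∘-zeroʳ : ∀ {X Y Z} (f : Hom Y Z) → f ∘ 0m {X} {Y} ≡ 0m
  ∘-zeroʳ f = HomGroup.identityʳ-unique (f ∘ 0m) (f ∘ 0m)
    (trans (sym (∘-distribˡ-+ f 0m 0m)) (cong (f ∘_) (+-identityˡ 0m)))

  ∘-zeroˡ : ∀ {X Y Z} (f : Hom X Y) → 0m {Y} {Z} ∘ f ≡ 0m
  ∘-zeroˡ f = HomGroup.identityʳ-unique (0m ∘ f) (0m ∘ f)
    (trans (sym (∘-distribʳ-+ 0m 0m f)) (cong (_∘ f) (+-identityˡ 0m)))

  split-id : ∀ {X Y} {s₁ s₂ : Hom Y Y} (t : Hom X Y) → s₁ + s₂ ≡ id →
             (s₁ ∘ t) + (s₂ ∘ t) ≡ t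
  split-id {s₁ = s₁} {s₂} t s₁+s₂ = begin
    (s₁ ∘ t) + (s₂ ∘ t)  ≡⟨ sym (∘-distribʳ-+ s₁ s₂ t) ⟩
    (s₁ + s₂) ∘ t        ≡⟨ cong (_∘ t) s₁+s₂ ⟩
    id ∘ t               ≡⟨ identityˡ t ⟩
    t                    ∎

  pullˡ : ∀ {W X Y Z} {g : Hom Y Z} {k : Hom X Y} {e : Hom X Z} (f : Hom W X) →
          g ∘ k ≡ e → g ∘ (k ∘ f) ≡ e ∘ f
  pullˡ f gk≡e = trans (sym (assoc _ _ f)) (cong (_∘ f) gk≡e)

  ⟨_,_⟩ : ∀ {Z X Y} → Hom Z X → Hom Z Y → Hom Z (X ⊕ Y)
  ⟨ u , v ⟩ = (κ₁ ∘ u) + (κ₂ ∘ v)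

  π₁⟨⟩ : ∀ {Z X Y} (u : Hom Z X) (v : Hom Z Y) → π₁ ∘ ⟨ u , v ⟩ ≡ u
  π₁⟨⟩ u v = begin
    π₁ ∘ ⟨ u , v ⟩                    ≡⟨ ∘-distribˡ-+ π₁ _ _ ⟩
    (π₁ ∘ (κ₁ ∘ u)) + (π₁ ∘ (κ₂ ∘ v))  ≡⟨ cong₂ _+_ (pullˡ u π₁κ₁) (pullˡ v π₁κ₂) ⟩
    (id ∘ u) + (0m ∘ v)               ≡⟨ cong₂ _+_ (identityˡ u) (∘-zeroˡ v) ⟩
    u + 0m                            ≡⟨ +-identityʳ u ⟩
    u                                 ∎

  π₂⟨⟩ : ∀ {Z X Y} (u : Hom Z X) (v : Hom Z Y) → π₂ ∘ ⟨ u , v ⟩ ≡ v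
  π₂⟨⟩ u v = begin
    π₂ ∘ ⟨ u , v ⟩                    ≡⟨ ∘-distribˡ-+ π₂ _ _ ⟩
    (π₂ ∘ (κ₁ ∘ u)) + (π₂ ∘ (κ₂ ∘ v))  ≡⟨ cong₂ _+_ (pullˡ u π₂κ₁) (pullˡ v π₂κ₂) ⟩
    (0m ∘ u) + (id ∘ v)               ≡⟨ cong₂ _+_ (∘-zeroˡ u) (identityˡ v) ⟩
    0m + v                            ≡⟨ +-identityˡ v ⟩
    v                                 ∎

  ⟨⟩-η : ∀ {Z X Y} (f : Hom Z (X ⊕ Y)) → f ≡ ⟨ π₁ ∘ f , π₂ ∘ f ⟩
  ⟨⟩-η f = begin
    f                                  ≡⟨ sym (identityˡ f) ⟩
    id ∘ f                             ≡⟨ cong (_∘ f) (sym κπ-sum) ⟩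
    ((κ₁ ∘ π₁) + (κ₂ ∘ π₂)) ∘ f        ≡⟨ ∘-distribʳ-+ _ _ f ⟩
    ((κ₁ ∘ π₁) ∘ f) + ((κ₂ ∘ π₂) ∘ f)  ≡⟨ cong₂ _+_ (assoc _ _ _) (assoc _ _ _) ⟩
    ⟨ π₁ ∘ f , π₂ ∘ f ⟩                ∎

  ⟨⟩-injective : ∀ {Z X Y} {u u' : Hom Z X} {v v' : Hom Z Y} →
                 ⟨ u , v ⟩ ≡ ⟨ u' , v' ⟩ → u ≡ u' × v ≡ v'
  ⟨⟩-injective {u = u} {u'} {v} {v'} eq =
    trans (sym (π₁⟨⟩ u v)) (trans (cong (π₁ ∘_) eq) (π₁⟨⟩ u' v')) ,
    trans (sym (π₂⟨⟩ u v)) (trans (cong (π₂ ∘_) eq) (π₂⟨⟩ u' v'))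

  ⟨⟩-∘ : ∀ {W Z X Y} (u : Hom Z X) (v : Hom Z Y) (t : Hom W Z) →
         ⟨ u , v ⟩ ∘ t ≡ ⟨ u ∘ t , v ∘ t ⟩
  ⟨⟩-∘ u v t = trans (∘-distribʳ-+ _ _ t) (cong₂ _+_ (assoc κ₁ u t) (assoc κ₂ v t))

  κ₁≡⟨id,0⟩ : ∀ {X Y} → κ₁ {X} {Y} ≡ ⟨ id , 0m ⟩
  κ₁≡⟨id,0⟩ = trans (⟨⟩-η κ₁) (cong₂ ⟨_,_⟩ π₁κ₁ π₂κ₁)

  κ₂≡⟨0,id⟩ : ∀ {X Y} → κ₂ {X} {Y} ≡ ⟨ 0m , id ⟩
  κ₂≡⟨0,id⟩ = trans (⟨⟩-η κ₂) (cong₂ ⟨_,_⟩ π₁κ₂ π₂κ₂)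

  ⟨⟩-+κ₂ : ∀ {Z X Y} (u : Hom Z X) (v d : Hom Z Y) →
           ⟨ u , v ⟩ + (κ₂ ∘ d) ≡ ⟨ u , v + d ⟩
  ⟨⟩-+κ₂ u v d = trans (+-assoc _ _ _) (cong ((κ₁ ∘ u) +_) (sym (∘-distribˡ-+ κ₂ v d)))

  [,]-∘-⟨⟩ : ∀ {W X Y Z} (f : Hom X Z) (g : Hom Y Z) (u : Hom W X) (v : Hom W Y) →
             [ f , g ] ∘ ⟨ u , v ⟩ ≡ (f ∘ u) + (g ∘ v)
  [,]-∘-⟨⟩ f g u v = begin
    [ f , g ] ∘ ⟨ u , v ⟩                             ≡⟨ ∘-distribʳ-+ _ _ _ ⟩
    ((f ∘ π₁) ∘ ⟨ u , v ⟩) + ((g ∘ π₂) ∘ ⟨ u , v ⟩)  ≡⟨ cong₂ _+_ (assoc _ _ _) (assoc _ _ _) ⟩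
    (f ∘ (π₁ ∘ ⟨ u , v ⟩)) + (g ∘ (π₂ ∘ ⟨ u , v ⟩))
      ≡⟨ cong₂ (λ u' v' → (f ∘ u') + (g ∘ v')) (π₁⟨⟩ u v) (π₂⟨⟩ u v) ⟩
    (f ∘ u) + (g ∘ v)                                ∎

  [,]-∘-κ₁ : ∀ {X Y Z} (f : Hom X Z) (g : Hom Y Z) → [ f , g ] ∘ κ₁ ≡ f
  [,]-∘-κ₁ f g = begin
    [ f , g ] ∘ κ₁           ≡⟨ cong ([ f , g ] ∘_) κ₁≡⟨id,0⟩ ⟩
    [ f , g ] ∘ ⟨ id , 0m ⟩  ≡⟨ [,]-∘-⟨⟩ f g id 0m ⟩
    (f ∘ id) + (g ∘ 0m)      ≡⟨ cong₂ _+_ (identityʳ f) (∘-zeroʳ g) ⟩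
    f + 0m                   ≡⟨ +-identityʳ f ⟩
    f                        ∎

  [,]-∘-κ₂ : ∀ {X Y Z} (f : Hom X Z) (g : Hom Y Z) → [ f , g ] ∘ κ₂ ≡ g
  [,]-∘-κ₂ f g = begin
    [ f , g ] ∘ κ₂           ≡⟨ cong ([ f , g ] ∘_) κ₂≡⟨0,id⟩ ⟩
    [ f , g ] ∘ ⟨ 0m , id ⟩  ≡⟨ [,]-∘-⟨⟩ f g 0m id ⟩
    (f ∘ 0m) + (g ∘ id)      ≡⟨ cong₂ _+_ (∘-zeroʳ f) (identityʳ g) ⟩
    0m + g                   ≡⟨ +-identityˡ g ⟩
    g                        ∎

  ∘-[,] : ∀ {X Y Z W} (k : Hom Z W) (f : Hom X Z) (g : Hom Y Z) →
          k ∘ [ f , g ] ≡ [ k ∘ f , k ∘ g ]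
  ∘-[,] k f g = trans (∘-distribˡ-+ k _ _) (cong₂ _+_ (sym (assoc k f π₁)) (sym (assoc k g π₂)))

  [,]-η : ∀ {X Y Z} (k : Hom (X ⊕ Y) Z) → k ≡ [ k ∘ κ₁ , k ∘ κ₂ ]
  [,]-η k = begin
    k                                  ≡⟨ sym (identityʳ k) ⟩
    k ∘ id                             ≡⟨ cong (k ∘_) (sym κπ-sum) ⟩
    k ∘ ((κ₁ ∘ π₁) + (κ₂ ∘ π₂))        ≡⟨ ∘-distribˡ-+ k _ _ ⟩
    (k ∘ (κ₁ ∘ π₁)) + (k ∘ (κ₂ ∘ π₂))  ≡⟨ cong₂ _+_ (sym (assoc _ _ _)) (sym (assoc _ _ _)) ⟩
    [ k ∘ κ₁ , k ∘ κ₂ ]                ∎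

  swap-∘-⟨⟩ : ∀ {Z X} (u v : Hom Z X) → swap ∘ ⟨ u , v ⟩ ≡ ⟨ v , u ⟩
  swap-∘-⟨⟩ u v = trans ([,]-∘-⟨⟩ κ₂ κ₁ u v) (+-comm _ _)

  ⊕₁-∘-⟨⟩ : ∀ {W X Y X' Y'} (f : Hom X X') (g : Hom Y Y') (u : Hom W X) (v : Hom W Y) →
            (f ⊕₁ g) ∘ ⟨ u , v ⟩ ≡ ⟨ f ∘ u , g ∘ v ⟩
  ⊕₁-∘-⟨⟩ f g u v = begin
    (f ⊕₁ g) ∘ ⟨ u , v ⟩                                   ≡⟨ ∘-distribʳ-+ _ _ _ ⟩
    ((κ₁ ∘ (f ∘ π₁)) ∘ ⟨ u , v ⟩) + ((κ₂ ∘ (g ∘ π₂)) ∘ ⟨ u , v ⟩)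
      ≡⟨ cong₂ _+_ (trans (assoc _ _ _) (cong (κ₁ ∘_) (assoc _ _ _)))
                   (trans (assoc _ _ _) (cong (κ₂ ∘_) (assoc _ _ _))) ⟩
    (κ₁ ∘ (f ∘ (π₁ ∘ ⟨ u , v ⟩))) + (κ₂ ∘ (g ∘ (π₂ ∘ ⟨ u , v ⟩)))
      ≡⟨ cong₂ (λ u' v' → (κ₁ ∘ (f ∘ u')) + (κ₂ ∘ (g ∘ v'))) (π₁⟨⟩ u v) (π₂⟨⟩ u v) ⟩
    ⟨ f ∘ u , g ∘ v ⟩                                      ∎

  ⟨⟩-† : ∀ {Z X Y} (g : Hom Z X) (k : Hom Z Y) → ⟨ g , k ⟩ † ≡ [ g † , k † ]
  ⟨⟩-† {Z} {X} {Y} g k =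
    trans ([,]-η (⟨ g , k ⟩ †)) (cong₂ [_,_] (restrict π₁† (π₁⟨⟩ g k)) (restrict π₂† (π₂⟨⟩ g k)))
    where
      restrict : ∀ {W} {π : Hom (X ⊕ Y) W} {κ : Hom W (X ⊕ Y)} {w : Hom Z W} →
                 π † ≡ κ → π ∘ ⟨ g , k ⟩ ≡ w → ⟨ g , k ⟩ † ∘ κ ≡ w †
      restrict {π = π} π†≡κ πgk≡w =
        trans (cong (⟨ g , k ⟩ † ∘_) (sym π†≡κ)) (trans (sym (†-∘ π _)) (cong _† πgk≡w))

  positive-0 : ∀ {X} → Positive (0m {X} {X})
  positive-0 {X} = X , 0m , sym (∘-zeroʳ _)

  positive-id : ∀ {X} → Positive (id {X})
  positive-id {X} = X , id , sym (trans (cong (_∘ id) †-id) (identityˡ id))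

  positive-+ : ∀ {X} {s t : Hom X X} → Positive s → Positive t → Positive (s + t)
  positive-+ {s = s} {t} (Y , g , s≡g†g) (Z , k , t≡k†k) = (Y ⊕ Z) , ⟨ g , k ⟩ , (begin
    s + t                        ≡⟨ cong₂ _+_ s≡g†g t≡k†k ⟩
    (g † ∘ g) + (k † ∘ k)        ≡⟨ sym ([,]-∘-⟨⟩ (g †) (k †) g k) ⟩
    [ g † , k † ] ∘ ⟨ g , k ⟩    ≡⟨ cong (_∘ ⟨ g , k ⟩) (sym (⟨⟩-† g k)) ⟩
    ⟨ g , k ⟩ † ∘ ⟨ g , k ⟩      ∎)

  positive-zerosumfree : ∀ {X} {s t : Hom X X} → Positive s → Positive t →
                         s + t ≡ 0m → s ≡ 0m × t ≡ 0m
  positive-zerosumfree (_ , g , s≡g†g) (_ , k , t≡k†k) s+t≡0 =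
    trans s≡g†g (proj₁ vanish) , trans t≡k†k (proj₂ vanish)
    where
      vanish : (g † ∘ g ≡ 0m) × (k † ∘ k ≡ 0m)
      vanish = zerosumfree g k (trans (sym (cong₂ _+_ s≡g†g t≡k†k)) s+t≡0)

  cancelʳ : ∀ {X Y Z} {k : Hom Y X} {k' : Hom X Y} {f g : Hom X Z} →
            k ∘ k' ≡ id → f ∘ k ≡ g ∘ k → f ≡ g
  cancelʳ {k = k} {k'} {f} {g} kk'≡id fk≡gk = begin
    f             ≡⟨ sym (identityʳ f) ⟩
    f ∘ id        ≡⟨ cong (f ∘_) (sym kk'≡id) ⟩
    f ∘ (k ∘ k')  ≡⟨ sym (assoc f k k') ⟩
    (f ∘ k) ∘ k'  ≡⟨ cong (_∘ k') fk≡gk ⟩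
    (g ∘ k) ∘ k'  ≡⟨ assoc g k k' ⟩
    g ∘ (k ∘ k')  ≡⟨ cong (g ∘_) kk'≡id ⟩
    g ∘ id        ≡⟨ identityʳ g ⟩
    g             ∎

  cancelˡ : ∀ {X Y Z} {k : Hom X Y} {k' : Hom Y X} {f g : Hom Z X} →
            k' ∘ k ≡ id → k ∘ f ≡ k ∘ g → f ≡ g
  cancelˡ {k = k} {k'} {f} {g} k'k≡id kf≡kg = begin
    f             ≡⟨ sym (identityˡ f) ⟩
    id ∘ f        ≡⟨ cong (_∘ f) (sym k'k≡id) ⟩
    (k' ∘ k) ∘ f  ≡⟨ assoc k' k f ⟩
    k' ∘ (k ∘ f)  ≡⟨ cong (k' ∘_) kf≡kg ⟩
    k' ∘ (k ∘ g)  ≡⟨ sym (assoc k' k g) ⟩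
    (k' ∘ k) ∘ g  ≡⟨ cong (_∘ g) k'k≡id ⟩
    id ∘ g        ≡⟨ identityˡ g ⟩
    g             ∎

  ∘-inverse : ∀ {X Y Z} {f : Hom Y Z} {f' : Hom Z Y} {g : Hom X Y} {g' : Hom Y X} →
              f ∘ f' ≡ id → g ∘ g' ≡ id → (f ∘ g) ∘ (g' ∘ f') ≡ id
  ∘-inverse {f = f} {f'} {g} {g'} ff'≡id gg'≡id = begin
    (f ∘ g) ∘ (g' ∘ f')  ≡⟨ assoc f g _ ⟩
    f ∘ (g ∘ (g' ∘ f'))  ≡⟨ cong (f ∘_) (pullˡ f' gg'≡id) ⟩
    f ∘ (id ∘ f')        ≡⟨ cong (f ∘_) (identityˡ f') ⟩
    f ∘ f'               ≡⟨ ff'≡id ⟩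
    id                   ∎

  ⊗-inverse : ∀ {X Y X' Y'} {f : Hom X X'} {f' : Hom X' X} {g : Hom Y Y'} {g' : Hom Y' Y} →
              f ∘ f' ≡ id → g ∘ g' ≡ id → (f ⊗₁ g) ∘ (f' ⊗₁ g') ≡ id
  ⊗-inverse ff'≡id gg'≡id = trans (sym (⊗-∘ _ _ _ _)) (trans (cong₂ _⊗₁_ ff'≡id gg'≡id) ⊗-id)

  id⊗-∘ : ∀ {X Y Z W} (f : Hom Y Z) (g : Hom X Y) → id {W} ⊗₁ (f ∘ g) ≡ (id ⊗₁ f) ∘ (id ⊗₁ g)
  id⊗-∘ f g = trans (cong (_⊗₁ (f ∘ g)) (sym (identityˡ id))) (⊗-∘ id id f g)

  ∘-⊗id : ∀ {X Y Z W} (f : Hom Y Z) (g : Hom X Y) → (f ∘ g) ⊗₁ id {W} ≡ (f ⊗₁ id) ∘ (g ⊗₁ id)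
  ∘-⊗id f g = trans (cong ((f ∘ g) ⊗₁_) (sym (identityˡ id))) (⊗-∘ f g id id)

  -- I ⊗ – is faithful, since it is isomorphic to the identity functor via λ.
  id⊗-injective : ∀ {X Y} {f g : Hom X Y} → id {I} ⊗₁ f ≡ id ⊗₁ g → f ≡ g
  id⊗-injective {f = f} {g} eq =
    cancelʳ λλ⁻¹ (trans (sym (λ-natural f)) (trans (cong (λ⊗ ∘_) eq) (λ-natural g)))

  -- After tensoring with I and precomposing
  -- with the isomorphism α ∘ (α ⊗ id), both sides become the same path
  -- by the pentagon, the triangle and naturality of α.
  λ-α : ∀ {X Y} → λ⊗ {X ⊗₀ Y} ∘ α {I} {X} {Y} ≡ λ⊗ {X} ⊗₁ id {Y}
  λ-α = id⊗-injective (cancelʳ (∘-inverse αα⁻¹ (⊗-inverse αα⁻¹ (identityˡ id))) (begin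
    (id ⊗₁ (λ⊗ ∘ α)) ∘ (α ∘ (α ⊗₁ id))          ≡⟨ cong (_∘ (α ∘ (α ⊗₁ id))) (id⊗-∘ λ⊗ α) ⟩
    ((id ⊗₁ λ⊗) ∘ (id ⊗₁ α)) ∘ (α ∘ (α ⊗₁ id))  ≡⟨ assoc _ _ _ ⟩
    (id ⊗₁ λ⊗) ∘ ((id ⊗₁ α) ∘ (α ∘ (α ⊗₁ id)))  ≡⟨ cong ((id ⊗₁ λ⊗) ∘_) pentagon ⟩
    (id ⊗₁ λ⊗) ∘ (α ∘ α)                        ≡⟨ sym (assoc _ _ _) ⟩
    ((id ⊗₁ λ⊗) ∘ α) ∘ α                        ≡⟨ cong (_∘ α) triangle ⟩
    (ρ⊗ ⊗₁ id) ∘ α                              ≡⟨ cong (λ i → (ρ⊗ ⊗₁ i) ∘ α) (sym ⊗-id) ⟩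
    (ρ⊗ ⊗₁ (id ⊗₁ id)) ∘ α                      ≡⟨ sym (α-natural ρ⊗ id id) ⟩
    α ∘ ((ρ⊗ ⊗₁ id) ⊗₁ id)                      ≡⟨ cong (λ r → α ∘ (r ⊗₁ id)) (sym triangle) ⟩
    α ∘ (((id ⊗₁ λ⊗) ∘ α) ⊗₁ id)                ≡⟨ cong (α ∘_) (∘-⊗id _ _) ⟩
    α ∘ (((id ⊗₁ λ⊗) ⊗₁ id) ∘ (α ⊗₁ id))        ≡⟨ sym (assoc _ _ _) ⟩
    (α ∘ ((id ⊗₁ λ⊗) ⊗₁ id)) ∘ (α ⊗₁ id)        ≡⟨ cong (_∘ (α ⊗₁ id)) (α-natural id λ⊗ id) ⟩
    ((id ⊗₁ (λ⊗ ⊗₁ id)) ∘ α) ∘ (α ⊗₁ id)        ≡⟨ assoc _ _ _ ⟩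
    (id ⊗₁ (λ⊗ ⊗₁ id)) ∘ (α ∘ (α ⊗₁ id))        ∎))

  -- On I ⊗ X, the functor I ⊗ – acts on λ as λ itself (naturality of λ
  -- at λ, cancelling the isomorphism λ).
  id⊗λ≡λ : ∀ {X} → id {I} ⊗₁ λ⊗ {X} ≡ λ⊗ {I ⊗₀ X}
  id⊗λ≡λ = cancelˡ λ⁻¹λ (λ-natural λ⊗)

  ρ≡λ : ρ⊗ {I} ≡ λ⊗ {I}
  ρ≡λ = cancelʳ ρρ⁻¹ (trans (sym (ρ-natural ρ⊗)) (trans (cong (ρ⊗ ∘_) ρ⊗id≡λ⊗id) (ρ-natural λ⊗)))
    where
      ρ⊗id≡λ⊗id : ρ⊗ {I} ⊗₁ id {I} ≡ λ⊗ {I} ⊗₁ id {I}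
      ρ⊗id≡λ⊗id = trans (sym triangle) (trans (cong (_∘ α) id⊗λ≡λ) λ-α)

  λ-conjugate : ∀ {X Y} (t : Hom X Y) → λ⊗ ∘ ((id {I} ⊗₁ t) ∘ λ⊗⁻¹) ≡ t
  λ-conjugate t = begin
    λ⊗ ∘ ((id ⊗₁ t) ∘ λ⊗⁻¹)  ≡⟨ pullˡ λ⊗⁻¹ (λ-natural t) ⟩
    (t ∘ λ⊗) ∘ λ⊗⁻¹          ≡⟨ assoc t λ⊗ λ⊗⁻¹ ⟩
    t ∘ (λ⊗ ∘ λ⊗⁻¹)          ≡⟨ cong (t ∘_) λλ⁻¹ ⟩
    t ∘ id                   ≡⟨ identityʳ t ⟩
    t                        ∎

  scalar-⊗ : (s t : Hom I I) → λ⊗ ∘ ((s ⊗₁ t) ∘ λ⊗⁻¹) ≡ s ∘ t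
  scalar-⊗ s t = begin
    λ⊗ ∘ ((s ⊗₁ t) ∘ λ⊗⁻¹)                   ≡⟨ cong (λ m → λ⊗ ∘ (m ∘ λ⊗⁻¹)) s⊗t-split ⟩
    λ⊗ ∘ (((s ⊗₁ id) ∘ (id ⊗₁ t)) ∘ λ⊗⁻¹)    ≡⟨ cong (λ⊗ ∘_) (assoc _ _ _) ⟩
    λ⊗ ∘ ((s ⊗₁ id) ∘ ((id ⊗₁ t) ∘ λ⊗⁻¹))    ≡⟨ pullˡ _ λ-s⊗id ⟩
    (s ∘ λ⊗) ∘ ((id ⊗₁ t) ∘ λ⊗⁻¹)            ≡⟨ assoc _ _ _ ⟩
    s ∘ (λ⊗ ∘ ((id ⊗₁ t) ∘ λ⊗⁻¹))            ≡⟨ cong (s ∘_) (λ-conjugate t) ⟩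
    s ∘ t                                    ∎
    where
      s⊗t-split : s ⊗₁ t ≡ (s ⊗₁ id) ∘ (id ⊗₁ t)
      s⊗t-split = trans (cong₂ _⊗₁_ (sym (identityʳ s)) (sym (identityˡ t))) (⊗-∘ s id id t)
      λ-s⊗id : λ⊗ ∘ (s ⊗₁ id) ≡ s ∘ λ⊗
      λ-s⊗id = begin
        λ⊗ ∘ (s ⊗₁ id)  ≡⟨ cong (_∘ (s ⊗₁ id)) (sym ρ≡λ) ⟩
        ρ⊗ ∘ (s ⊗₁ id)  ≡⟨ ρ-natural s ⟩
        s ∘ ρ⊗          ≡⟨ cong (s ∘_) ρ≡λ ⟩
        s ∘ λ⊗          ∎

  positive-∘ : {s t : Hom I I} → Positive s → Positive t → Positive (s ∘ t)
  positive-∘ {s} {t} (Y , g , s≡g†g) (Z , k , t≡k†k) = (Y ⊗₀ Z) , (g ⊗₁ k) ∘ λ⊗⁻¹ , sym (begin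
    ((g ⊗₁ k) ∘ λ⊗⁻¹) † ∘ ((g ⊗₁ k) ∘ λ⊗⁻¹)
      ≡⟨ cong (_∘ ((g ⊗₁ k) ∘ λ⊗⁻¹)) (†-∘ _ _) ⟩
    (λ⊗⁻¹ † ∘ (g ⊗₁ k) †) ∘ ((g ⊗₁ k) ∘ λ⊗⁻¹)
      ≡⟨ cong₂ (λ l m → (l ∘ m) ∘ ((g ⊗₁ k) ∘ λ⊗⁻¹)) λ⁻¹-unitary (†-⊗ g k) ⟩
    (λ⊗ ∘ (g † ⊗₁ k †)) ∘ ((g ⊗₁ k) ∘ λ⊗⁻¹)
      ≡⟨ trans (assoc _ _ _) (cong (λ⊗ ∘_) (sym (assoc _ _ _))) ⟩
    λ⊗ ∘ (((g † ⊗₁ k †) ∘ (g ⊗₁ k)) ∘ λ⊗⁻¹)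
      ≡⟨ cong (λ m → λ⊗ ∘ (m ∘ λ⊗⁻¹)) (sym (⊗-∘ _ _ _ _)) ⟩
    λ⊗ ∘ (((g † ∘ g) ⊗₁ (k † ∘ k)) ∘ λ⊗⁻¹)
      ≡⟨ cong₂ (λ l m → λ⊗ ∘ ((l ⊗₁ m) ∘ λ⊗⁻¹)) (sym s≡g†g) (sym t≡k†k) ⟩
    λ⊗ ∘ ((s ⊗₁ t) ∘ λ⊗⁻¹)
      ≡⟨ scalar-⊗ s t ⟩
    s ∘ t ∎)
    where
      λ⁻¹-unitary : λ⊗⁻¹ {I} † ≡ λ⊗
      λ⁻¹-unitary = trans (cong _† (sym λ-unitary)) (†-involutive λ⊗)

  ⟨⟩-isPPred : ∀ {X} {u v : Hom X X} → Positive u → Positive v → u + v ≡ id →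
               IsPPred ⟨ u , v ⟩
  ⟨⟩-isPPred {u = u} {v} pos-u pos-v u+v≡id =
    subst Positive (sym (π₁⟨⟩ u v)) pos-u ,
    subst Positive (sym (π₂⟨⟩ u v)) pos-v ,
    trans (cong₂ _+_ (π₁⟨⟩ u v) (π₂⟨⟩ u v)) u+v≡id

  swap-components : ∀ {Z X} (x : Hom Z (X ⊕ X)) → swap ∘ x ≡ ⟨ π₂ ∘ x , π₁ ∘ x ⟩
  swap-components x = trans (cong (swap ∘_) (⟨⟩-η x)) (swap-∘-⟨⟩ _ _)

  record Decomposition {X : Obj} (x y z : Hom X (X ⊕ X)) : Set (o ⊔ h) where
    constructor decomposition
    field
      a c d : Hom X X
      positive-a : Positive a
      positive-c : Positive c
      positive-d : Positive d
      total : (a + c) + d ≡ id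
      x≡ : x ≡ ⟨ a , c + d ⟩
      y≡ : y ≡ ⟨ c , a + d ⟩
      z≡ : z ≡ ⟨ a + c , d ⟩

  bound : ∀ {X} (a c d : Hom X X) → Hom X ((X ⊕ X) ⊕ X)
  bound a c d = ⟨ ⟨ a , c ⟩ , d ⟩

  bound-η : ∀ {X} (b : Hom X ((X ⊕ X) ⊕ X)) → b ≡ bound (π₁ ∘ (π₁ ∘ b)) (π₂ ∘ (π₁ ∘ b)) (π₂ ∘ b)
  bound-η b = trans (⟨⟩-η b) (cong ⟨_, π₂ ∘ b ⟩ (⟨⟩-η (π₁ ∘ b)))

  bound-first : ∀ {X} (a c d : Hom X X) → [ id , κ₂ ] ∘ bound a c d ≡ ⟨ a , c + d ⟩
  bound-first a c d = begin
    [ id , κ₂ ] ∘ bound a c d        ≡⟨ [,]-∘-⟨⟩ id κ₂ ⟨ a , c ⟩ d ⟩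
    (id ∘ ⟨ a , c ⟩) + (κ₂ ∘ d)      ≡⟨ cong (_+ (κ₂ ∘ d)) (identityˡ _) ⟩
    ⟨ a , c ⟩ + (κ₂ ∘ d)             ≡⟨ ⟨⟩-+κ₂ a c d ⟩
    ⟨ a , c + d ⟩                    ∎

  bound-second : ∀ {X} (a c d : Hom X X) → [ swap , κ₂ ] ∘ bound a c d ≡ ⟨ c , a + d ⟩
  bound-second a c d = begin
    [ swap , κ₂ ] ∘ bound a c d      ≡⟨ [,]-∘-⟨⟩ swap κ₂ ⟨ a , c ⟩ d ⟩
    (swap ∘ ⟨ a , c ⟩) + (κ₂ ∘ d)    ≡⟨ cong (_+ (κ₂ ∘ d)) (swap-∘-⟨⟩ a c) ⟩
    ⟨ c , a ⟩ + (κ₂ ∘ d)             ≡⟨ ⟨⟩-+κ₂ c a d ⟩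
    ⟨ c , a + d ⟩                    ∎

  bound-sum : ∀ {X} (a c d : Hom X X) → (∇ ⊕₁ id) ∘ bound a c d ≡ ⟨ a + c , d ⟩
  bound-sum a c d = begin
    (∇ ⊕₁ id) ∘ bound a c d          ≡⟨ ⊕₁-∘-⟨⟩ ∇ id ⟨ a , c ⟩ d ⟩
    ⟨ ∇ ∘ ⟨ a , c ⟩ , id ∘ d ⟩       ≡⟨ cong₂ ⟨_,_⟩ ([,]-∘-⟨⟩ id id a c) (identityˡ d) ⟩
    ⟨ (id ∘ a) + (id ∘ c) , d ⟩      ≡⟨ cong ⟨_, d ⟩ (cong₂ _+_ (identityˡ a) (identityˡ c)) ⟩
    ⟨ a + c , d ⟩                    ∎

  bound-isPosBound : ∀ {X} {a c d : Hom X X} → Positive a → Positive c → Positive d →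
                     (a + c) + d ≡ id → IsPosBound (bound a c d)
  bound-isPosBound {a = a} {c} {d} pos-a pos-c pos-d total =
    subst Positive (sym first) pos-a , subst Positive (sym second) pos-c ,
    subst Positive (sym third) pos-d ,
    trans (cong₂ (λ a' c' → (a' + c') + (π₂ ∘ bound a c d)) first second)
          (trans (cong ((a + c) +_) third) total)
    where
      first : π₁ ∘ (π₁ ∘ bound a c d) ≡ a
      first = trans (cong (π₁ ∘_) (π₁⟨⟩ _ d)) (π₁⟨⟩ a c)
      second : π₂ ∘ (π₁ ∘ bound a c d) ≡ c
      second = trans (cong (π₂ ∘_) (π₁⟨⟩ _ d)) (π₂⟨⟩ a c)
      third : π₂ ∘ bound a c d ≡ d
      third = π₂⟨⟩ ⟨ a , c ⟩ d

  decompose : ∀ {X} {x y z : Hom X (X ⊕ X)} → PSum x y z → Decomposition x y z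
  decompose (b , (pos-a , pos-c , pos-d , total) , b-first , b-second , b-sum) =
    decomposition _ _ _ pos-a pos-c pos-d total
      (trans (sym b-first) (trans (cong ([ id , κ₂ ] ∘_) (bound-η b)) (bound-first _ _ _)))
      (trans (sym b-second) (trans (cong ([ swap , κ₂ ] ∘_) (bound-η b)) (bound-second _ _ _)))
      (trans (sym b-sum) (trans (cong ((∇ ⊕₁ id) ∘_) (bound-η b)) (bound-sum _ _ _)))

  compose : ∀ {X} {x y z : Hom X (X ⊕ X)} → Decomposition x y z → PSum x y z
  compose (decomposition a c d pos-a pos-c pos-d total x≡ y≡ z≡) =
    bound a c d , bound-isPosBound pos-a pos-c pos-d total ,
    trans (bound-first a c d) (sym x≡) ,
    trans (bound-second a c d) (sym y≡) ,
    trans (bound-sum a c d) (sym z≡)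

  κ₂-isPPred : ∀ {X} → IsPPred (κ₂ {X} {X})
  κ₂-isPPred = subst IsPPred (sym κ₂≡⟨0,id⟩) (⟨⟩-isPPred positive-0 positive-id (+-identityˡ id))

  κ₁-isPPred : ∀ {X} → IsPPred (κ₁ {X} {X})
  κ₁-isPPred = subst IsPPred (sym κ₁≡⟨id,0⟩) (⟨⟩-isPPred positive-id positive-0 (+-identityʳ id))

  swap-isPPred : ∀ {X} {x : Hom X (X ⊕ X)} → IsPPred x → IsPPred (swap ∘ x)
  swap-isPPred {x = x} (pos₁ , pos₂ , sum) =
    subst IsPPred (sym (swap-components x)) (⟨⟩-isPPred pos₂ pos₁ (trans (+-comm _ _) sum))

  ⊞-isPPred : ∀ {X} {x y z : Hom X (X ⊕ X)} → PSum x y z → IsPPred z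
  ⊞-isPPred s with decompose s
  ... | decomposition a c d pos-a pos-c pos-d total _ _ z≡ =
    subst IsPPred (sym z≡) (⟨⟩-isPPred (positive-+ pos-a pos-c) pos-d total)

  -- The decomposition of x ⊞ y is determined by x and y: a and c are
  -- components of x and y, and d is fixed by a + c + d = id.
  ⊞-functional : ∀ {X} {x y z z' : Hom X (X ⊕ X)} → PSum x y z → PSum x y z' → z ≡ z'
  ⊞-functional s s' with decompose s | decompose s'
  ... | decomposition a c d _ _ _ total x≡ y≡ z≡
      | decomposition a' c' d' _ _ _ total' x≡' y≡' z≡' =
    trans z≡ (trans (cong₂ ⟨_,_⟩ (cong₂ _+_ a≡a' c≡c') d≡d') (sym z≡'))
    where
      a≡a' : a ≡ a'
      a≡a' = proj₁ (⟨⟩-injective (trans (sym x≡) x≡'))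
      c≡c' : c ≡ c'
      c≡c' = proj₁ (⟨⟩-injective (trans (sym y≡) y≡'))
      d≡d' : d ≡ d'
      d≡d' = +-cancelˡ (a + c)
        (trans total (sym (trans (cong₂ (λ a'' c'' → (a'' + c'') + d') a≡a' c≡c') total')))

  ⊞-comm : ∀ {X} {x y z : Hom X (X ⊕ X)} → PSum x y z → PSum y x z
  ⊞-comm s with decompose s
  ... | decomposition a c d pos-a pos-c pos-d total x≡ y≡ z≡ =
    compose (decomposition c a d pos-c pos-a pos-d
      (trans (cong (_+ d) (+-comm c a)) total) y≡ x≡ (trans z≡ (cong ⟨_, d ⟩ (+-comm a c))))

  -- Associativity: from x ⊞ y = u with parts a₁, c₁, d₁ and u ⊞ z = v with
  -- parts a₂, c₂, d₂ (so a₂ = a₁ + c₁ and d₁ = c₂ + d₂), the sum y ⊞ z is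
  -- w = ⟨c₁ + c₂, a₁ + d₂⟩ and x ⊞ w = v.
  ⊞-assoc : ∀ {X} {x y z u v : Hom X (X ⊕ X)} → PSum x y u → PSum u z v →
            Σ (Hom X (X ⊕ X)) λ w → PSum y z w × PSum x w v
  ⊞-assoc s₁ s₂ with decompose s₁ | decompose s₂
  ... | decomposition a₁ c₁ d₁ pos-a₁ pos-c₁ _ _ x≡ y≡ u≡
      | decomposition a₂ c₂ d₂ _ pos-c₂ pos-d₂ total₂ u≡' z≡ v≡ =
    ⟨ c₁ + c₂ , a₁ + d₂ ⟩ ,
    compose (decomposition c₁ c₂ (a₁ + d₂) pos-c₁ pos-c₂ (positive-+ pos-a₁ pos-d₂)
      total-yz (trans y≡ (cong ⟨ c₁ ,_⟩ y-second)) (trans z≡ (cong ⟨ c₂ ,_⟩ z-second)) refl) ,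
    compose (decomposition a₁ (c₁ + c₂) d₂ pos-a₁ (positive-+ pos-c₁ pos-c₂) pos-d₂
      total-xw (trans x≡ (cong ⟨ a₁ ,_⟩ x-second)) refl (trans v≡ (cong ⟨_, d₂ ⟩ v-first)))
    where
      a₁+c₁≡a₂ : a₁ + c₁ ≡ a₂
      a₁+c₁≡a₂ = proj₁ (⟨⟩-injective (trans (sym u≡) u≡'))
      d₁≡c₂+d₂ : d₁ ≡ c₂ + d₂
      d₁≡c₂+d₂ = proj₂ (⟨⟩-injective (trans (sym u≡) u≡'))
      x-second : c₁ + d₁ ≡ (c₁ + c₂) + d₂
      x-second = trans (cong (c₁ +_) d₁≡c₂+d₂) (sym (+-assoc c₁ c₂ d₂))
      y-second : a₁ + d₁ ≡ c₂ + (a₁ + d₂)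
      y-second = trans (cong (a₁ +_) d₁≡c₂+d₂) (HomCommutative.x∙yz≈y∙xz a₁ c₂ d₂)
      z-second : a₂ + d₂ ≡ c₁ + (a₁ + d₂)
      z-second = trans (cong (_+ d₂) (sym a₁+c₁≡a₂)) (HomCommutative.xy∙z≈y∙xz a₁ c₁ d₂)
      v-first : a₂ + c₂ ≡ a₁ + (c₁ + c₂)
      v-first = trans (cong (_+ c₂) (sym a₁+c₁≡a₂)) (+-assoc a₁ c₁ c₂)
      total-xw : (a₁ + (c₁ + c₂)) + d₂ ≡ id
      total-xw = trans (cong (_+ d₂) (sym v-first)) total₂
      total-yz : (c₁ + c₂) + (a₁ + d₂) ≡ id
      total-yz = trans (HomCommutative.x∙yz≈yx∙z (c₁ + c₂) a₁ d₂) total-xw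

  κ₂-⊞ : ∀ {X} {x : Hom X (X ⊕ X)} → IsPPred x → PSum κ₂ x x
  κ₂-⊞ {x = x} (pos₁ , pos₂ , sum) =
    compose (decomposition 0m (π₁ ∘ x) (π₂ ∘ x) positive-0 pos₁ pos₂
      (trans (cong (_+ (π₂ ∘ x)) (+-identityˡ _)) sum)
      (trans κ₂≡⟨0,id⟩ (cong ⟨ 0m ,_⟩ (sym sum)))
      (trans (⟨⟩-η x) (cong ⟨ π₁ ∘ x ,_⟩ (sym (+-identityˡ _))))
      (trans (⟨⟩-η x) (cong ⟨_, π₂ ∘ x ⟩ (sym (+-identityˡ _)))))

  swap-⊞ : ∀ {X} {x : Hom X (X ⊕ X)} → IsPPred x → PSum x (swap ∘ x) κ₁
  swap-⊞ {x = x} (pos₁ , pos₂ , sum) =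
    compose (decomposition (π₁ ∘ x) (π₂ ∘ x) 0m pos₁ pos₂ positive-0
      (trans (+-identityʳ _) sum)
      (trans (⟨⟩-η x) (cong ⟨ π₁ ∘ x ,_⟩ (sym (+-identityʳ _))))
      (trans (swap-components x) (cong ⟨ π₂ ∘ x ,_⟩ (sym (+-identityʳ _))))
      (trans κ₁≡⟨id,0⟩ (cong ⟨_, 0m ⟩ (sym sum))))

  -- If x ⊞ y = 1 then the remainder d vanishes, so y = swap ∘ x.
  swap-unique : ∀ {X} {x y : Hom X (X ⊕ X)} → PSum x y κ₁ → y ≡ swap ∘ x
  swap-unique {x = x} {y} s with decompose s
  ... | decomposition a c d _ _ _ _ x≡ y≡ z≡ = begin
    y                  ≡⟨ y≡ ⟩
    ⟨ c , a + d ⟩      ≡⟨ cong₂ ⟨_,_⟩ (sym c+d≡c) a+d≡a ⟩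
    ⟨ c + d , a ⟩      ≡⟨ sym (swap-∘-⟨⟩ a (c + d)) ⟩
    swap ∘ ⟨ a , c + d ⟩  ≡⟨ cong (swap ∘_) (sym x≡) ⟩
    swap ∘ x           ∎
    where
      d≡0 : d ≡ 0m
      d≡0 = sym (proj₂ (⟨⟩-injective (trans (sym κ₁≡⟨id,0⟩) z≡)))
      a+d≡a : a + d ≡ a
      a+d≡a = trans (cong (a +_) d≡0) (+-identityʳ a)
      c+d≡c : c + d ≡ c
      c+d≡c = trans (cong (c +_) d≡0) (+-identityʳ c)

  -- If x ⊞ 1 is defined then c = id and a + d = 0, so a = d = 0 by
  -- zerosumfreeness and x = 0.
  ⊞-κ₁ : ∀ {X} {x z : Hom X (X ⊕ X)} → PSum x κ₁ z → x ≡ κ₂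
  ⊞-κ₁ {x = x} s with decompose s
  ... | decomposition a c d pos-a _ pos-d _ x≡ y≡ _ = begin
    x                  ≡⟨ x≡ ⟩
    ⟨ a , c + d ⟩      ≡⟨ cong₂ (λ a' d' → ⟨ a' , c + d' ⟩) a≡0 d≡0 ⟩
    ⟨ 0m , c + 0m ⟩    ≡⟨ cong ⟨ 0m ,_⟩ (trans (+-identityʳ c) c≡id) ⟩
    ⟨ 0m , id ⟩        ≡⟨ sym κ₂≡⟨0,id⟩ ⟩
    κ₂                 ∎
    where
      κ₁-components : id ≡ c × 0m ≡ a + d
      κ₁-components = ⟨⟩-injective (trans (sym κ₁≡⟨id,0⟩) y≡)
      c≡id : c ≡ id
      c≡id = sym (proj₁ κ₁-components)
      a≡0 : a ≡ 0m
      a≡0 = proj₁ (positive-zerosumfree pos-a pos-d (sym (proj₂ κ₁-components)))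
      d≡0 : d ≡ 0m
      d≡0 = proj₂ (positive-zerosumfree pos-a pos-d (sym (proj₂ κ₁-components)))

  pPred-isEffectAlgebra : ∀ {X} → IsEffectAlgebra (IsPPred {X}) (PSum {X}) κ₂ κ₁ (λ p → swap ∘ p)
  pPred-isEffectAlgebra = record
    { 𝟘-in = κ₂-isPPred
    ; 𝟙-in = κ₁-isPPred
    ; ᗮ-in = swap-isPPred
    ; S-in = λ _ _ → ⊞-isPPred
    ; S-functional = λ _ _ → ⊞-functional
    ; S-comm = λ _ _ → ⊞-comm
    ; S-assoc = λ _ _ _ → ⊞-assoc
    ; S-𝟘 = κ₂-⊞
    ; ᗮ-sum = swap-⊞
    ; ᗮ-unique = λ _ _ → swap-unique
    ; zero-one = λ _ → ⊞-κ₁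
    }

  -- The product [ p , κ₂ ] ∘ q is Kleisli composition for the monad
  -- (–) ⊕ X, so it is associative with unit κ₁ for arbitrary maps.
  kleisli-assoc : ∀ {X} (p q r : Hom X (X ⊕ X)) →
                  [ [ p , κ₂ ] ∘ q , κ₂ ] ∘ r ≡ [ p , κ₂ ] ∘ ([ q , κ₂ ] ∘ r)
  kleisli-assoc p q r = begin
    [ [ p , κ₂ ] ∘ q , κ₂ ] ∘ r
      ≡⟨ cong (λ k → [ [ p , κ₂ ] ∘ q , k ] ∘ r) (sym ([,]-∘-κ₂ p κ₂)) ⟩
    [ [ p , κ₂ ] ∘ q , [ p , κ₂ ] ∘ κ₂ ] ∘ r
      ≡⟨ cong (_∘ r) (sym (∘-[,] [ p , κ₂ ] q κ₂)) ⟩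
    ([ p , κ₂ ] ∘ [ q , κ₂ ]) ∘ r
      ≡⟨ assoc _ _ r ⟩
    [ p , κ₂ ] ∘ ([ q , κ₂ ] ∘ r)
      ∎

  kleisli-identityˡ : ∀ {X} (q : Hom X (X ⊕ X)) → [ κ₁ , κ₂ ] ∘ q ≡ q
  kleisli-identityˡ q = trans (cong (_∘ q) κπ-sum) (identityˡ q)

  kleisli-⟨⟩ : ∀ {X} (s₁ s₂ t₁ t₂ : Hom X X) →
               [ ⟨ s₁ , s₂ ⟩ , κ₂ ] ∘ ⟨ t₁ , t₂ ⟩ ≡ ⟨ s₁ ∘ t₁ , (s₂ ∘ t₁) + t₂ ⟩
  kleisli-⟨⟩ s₁ s₂ t₁ t₂ = begin
    [ ⟨ s₁ , s₂ ⟩ , κ₂ ] ∘ ⟨ t₁ , t₂ ⟩    ≡⟨ [,]-∘-⟨⟩ ⟨ s₁ , s₂ ⟩ κ₂ t₁ t₂ ⟩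
    (⟨ s₁ , s₂ ⟩ ∘ t₁) + (κ₂ ∘ t₂)         ≡⟨ cong (_+ (κ₂ ∘ t₂)) (⟨⟩-∘ s₁ s₂ t₁) ⟩
    ⟨ s₁ ∘ t₁ , s₂ ∘ t₁ ⟩ + (κ₂ ∘ t₂)      ≡⟨ ⟨⟩-+κ₂ (s₁ ∘ t₁) (s₂ ∘ t₁) t₂ ⟩
    ⟨ s₁ ∘ t₁ , (s₂ ∘ t₁) + t₂ ⟩           ∎

  ·-⟨⟩ : {p q : Hom I (I ⊕ I)} {s₁ s₂ t₁ t₂ : Hom I I} →
         p ≡ ⟨ s₁ , s₂ ⟩ → q ≡ ⟨ t₁ , t₂ ⟩ → p · q ≡ ⟨ s₁ ∘ t₁ , (s₂ ∘ t₁) + t₂ ⟩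
  ·-⟨⟩ p≡ q≡ = trans (cong₂ _·_ p≡ q≡) (kleisli-⟨⟩ _ _ _ _)

  π₁-· : (p q : Hom I (I ⊕ I)) → π₁ ∘ (p · q) ≡ (π₁ ∘ p) ∘ (π₁ ∘ q)
  π₁-· p q = trans (cong (π₁ ∘_) (·-⟨⟩ (⟨⟩-η p) (⟨⟩-η q))) (π₁⟨⟩ _ _)

  ·-isPPred : {p q : Hom I (I ⊕ I)} → IsPPred p → IsPPred q → IsPPred (p · q)
  ·-isPPred {p} {q} (pos-s₁ , pos-s₂ , s₁+s₂≡id) (pos-t₁ , pos-t₂ , t₁+t₂≡id) =
    subst IsPPred (sym (·-⟨⟩ (⟨⟩-η p) (⟨⟩-η q)))
      (⟨⟩-isPPred (positive-∘ pos-s₁ pos-t₁) (positive-+ (positive-∘ pos-s₂ pos-t₁) pos-t₂)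
        (trans (sym (+-assoc _ _ _))
               (trans (cong (_+ (π₂ ∘ q)) (split-id (π₁ ∘ q) s₁+s₂≡id)) t₁+t₂≡id)))

  -- Left distributivity: multiplying a decomposition a, c, d on the left by
  -- x = ⟨s₁, s₂⟩ gives the decomposition s₁ ∘ a, s₁ ∘ c, s₂ ∘ (a + c) + d.
  -- The second components agree because s₁ ∘ c + s₂ ∘ c = c.
  redistribute : ∀ {X} {s₁ s₂ : Hom X X} (a c d : Hom X X) → s₁ + s₂ ≡ id →
                 (s₂ ∘ a) + (c + d) ≡ (s₁ ∘ c) + ((s₂ ∘ (a + c)) + d)
  redistribute {s₁ = s₁} {s₂} a c d s₁+s₂≡id = begin
    (s₂ ∘ a) + (c + d)
      ≡⟨ cong (λ c' → (s₂ ∘ a) + (c' + d)) (sym (split-id c s₁+s₂≡id)) ⟩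
    (s₂ ∘ a) + (((s₁ ∘ c) + (s₂ ∘ c)) + d)
      ≡⟨ +-exchange (s₂ ∘ a) (s₁ ∘ c) (s₂ ∘ c) d ⟩
    (s₁ ∘ c) + (((s₂ ∘ a) + (s₂ ∘ c)) + d)
      ≡⟨ cong (λ e → (s₁ ∘ c) + (e + d)) (sym (∘-distribˡ-+ s₂ a c)) ⟩
    (s₁ ∘ c) + ((s₂ ∘ (a + c)) + d)
      ∎

  ·-⊞ˡ : {x y z u : Hom I (I ⊕ I)} → IsPPred x → PSum y z u → PSum (x · y) (x · z) (x · u)
  ·-⊞ˡ {x} (pos-s₁ , pos-s₂ , s₁+s₂≡id) s with decompose s
  ... | decomposition a c d pos-a pos-c pos-d total y≡ z≡ u≡ =
    compose (decomposition (s₁ ∘ a) (s₁ ∘ c) ((s₂ ∘ (a + c)) + d)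
      (positive-∘ pos-s₁ pos-a) (positive-∘ pos-s₁ pos-c)
      (positive-+ (positive-∘ pos-s₂ (positive-+ pos-a pos-c)) pos-d)
      total′
      (trans (·-⟨⟩ x≡ y≡) (cong ⟨ s₁ ∘ a ,_⟩ (redistribute a c d s₁+s₂≡id)))
      (trans (·-⟨⟩ x≡ z≡) (cong ⟨ s₁ ∘ c ,_⟩ (trans (redistribute c a d s₁+s₂≡id)
        (cong (λ e → (s₁ ∘ a) + ((s₂ ∘ e) + d)) (+-comm c a)))))
      (trans (·-⟨⟩ x≡ u≡) (cong ⟨_, (s₂ ∘ (a + c)) + d ⟩ (∘-distribˡ-+ s₁ a c))))
    where
      s₁ s₂ : Hom I I
      s₁ = π₁ ∘ x
      s₂ = π₂ ∘ x
      x≡ : x ≡ ⟨ s₁ , s₂ ⟩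
      x≡ = ⟨⟩-η x
      total′ : ((s₁ ∘ a) + (s₁ ∘ c)) + ((s₂ ∘ (a + c)) + d) ≡ id
      total′ = begin
        ((s₁ ∘ a) + (s₁ ∘ c)) + ((s₂ ∘ (a + c)) + d)
          ≡⟨ cong (_+ ((s₂ ∘ (a + c)) + d)) (sym (∘-distribˡ-+ s₁ a c)) ⟩
        (s₁ ∘ (a + c)) + ((s₂ ∘ (a + c)) + d)
          ≡⟨ sym (+-assoc _ _ d) ⟩
        ((s₁ ∘ (a + c)) + (s₂ ∘ (a + c))) + d
          ≡⟨ cong (_+ d) (split-id (a + c) s₁+s₂≡id) ⟩
        (a + c) + d
          ≡⟨ total ⟩
        id
          ∎

  -- Right distributivity: multiplying on the right by x = ⟨t₁, t₂⟩ gives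
  -- the decomposition a ∘ t₁, c ∘ t₁, d ∘ t₁ + t₂.
  distribute-first : ∀ {X} (c d t₁ t₂ : Hom X X) →
                     ((c + d) ∘ t₁) + t₂ ≡ (c ∘ t₁) + ((d ∘ t₁) + t₂)
  distribute-first c d t₁ t₂ = trans (cong (_+ t₂) (∘-distribʳ-+ c d t₁)) (+-assoc _ _ t₂)

  ·-⊞ʳ : {x y z u : Hom I (I ⊕ I)} → IsPPred x → PSum y z u → PSum (y · x) (z · x) (u · x)
  ·-⊞ʳ {x} (pos-t₁ , pos-t₂ , t₁+t₂≡id) s with decompose s
  ... | decomposition a c d pos-a pos-c pos-d total y≡ z≡ u≡ =
    compose (decomposition (a ∘ t₁) (c ∘ t₁) ((d ∘ t₁) + t₂)
      (positive-∘ pos-a pos-t₁) (positive-∘ pos-c pos-t₁)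
      (positive-+ (positive-∘ pos-d pos-t₁) pos-t₂)
      total′
      (trans (·-⟨⟩ y≡ x≡) (cong ⟨ a ∘ t₁ ,_⟩ (distribute-first c d t₁ t₂)))
      (trans (·-⟨⟩ z≡ x≡) (cong ⟨ c ∘ t₁ ,_⟩ (distribute-first a d t₁ t₂)))
      (trans (·-⟨⟩ u≡ x≡) (cong ⟨_, (d ∘ t₁) + t₂ ⟩ (∘-distribʳ-+ a c t₁))))
    where
      t₁ t₂ : Hom I I
      t₁ = π₁ ∘ x
      t₂ = π₂ ∘ x
      x≡ : x ≡ ⟨ t₁ , t₂ ⟩
      x≡ = ⟨⟩-η x
      total′ : ((a ∘ t₁) + (c ∘ t₁)) + ((d ∘ t₁) + t₂) ≡ id
      total′ = begin
        ((a ∘ t₁) + (c ∘ t₁)) + ((d ∘ t₁) + t₂)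
          ≡⟨ cong (_+ ((d ∘ t₁) + t₂)) (sym (∘-distribʳ-+ a c t₁)) ⟩
        ((a + c) ∘ t₁) + ((d ∘ t₁) + t₂)
          ≡⟨ sym (distribute-first (a + c) d t₁ t₂) ⟩
        (((a + c) + d) ∘ t₁) + t₂
          ≡⟨ cong (λ e → (e ∘ t₁) + t₂) total ⟩
        (id ∘ t₁) + t₂
          ≡⟨ cong (_+ t₂) (identityˡ t₁) ⟩
        t₁ + t₂
          ≡⟨ t₁+t₂≡id ⟩
        id
          ∎

  pPred-isEffectMonoid : IsEffectMonoid (IsPPred {I}) (PSum {I}) κ₂ κ₁ (λ p → swap ∘ p) _·_
  pPred-isEffectMonoid = record
    { isEffectAlgebra = pPred-isEffectAlgebra
    ; ⋆-in = ·-isPPred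
    ; ⋆-assoc = λ {p} {q} {r} _ _ _ → kleisli-assoc p q r
    ; ⋆-identityˡ = λ {q} _ → kleisli-identityˡ q
    ; ⋆-identityʳ = λ {p} _ → [,]-∘-κ₁ p κ₂
    ; ⋆-⊞ˡ = λ x-pred _ _ → ·-⊞ˡ x-pred
    ; ⋆-⊞ʳ = λ x-pred _ _ → ·-⊞ʳ x-pred
    }

lemma7p5 : ∀ {o h : Level} (C : ZSFDaggerMonoidalAdditive o h) →
    let open ZSFDaggerMonoidalAdditive C in
      IsEffectMonoid (IsPPred {I}) (PSum {I}) κ₂ κ₁ (λ p → swap ∘ p) _·_
    × (∀ (p q : Hom I (I ⊕ I)) → IsPPred p → IsPPred q →
         π₁ ∘ (p · q) ≡ (π₁ ∘ p) ∘ (π₁ ∘ q))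
lemma7p5 C = pPred-isEffectMonoid , λ p q _ _ → π₁-· p q
  where open EffectMonoidOfScalars C
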